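{- Let $H$ be a graph, and $G=H \odot K_1$. Then (1) $G$ is $A$-AW for all $\ell \in \mathbb{N}$; (2) if $G$ has size $m$ and order $n$, then $T_{V(G)}^{A(G)}(1)=\{ 2(m-n) \}$; (3) if $G$ is a pendant forest with $c$ components, then $T_{V(G)}^{A(G)}(1)=\{ -2c \}$.
   Context: $H\odot K_1$ denotes the graph obtained from $H$ by adding, for each vertex $v$ of $H$, a new vertex adjacent only to $v$ (a pendant graph; a pendant forest is such a graph that is a forest). Adjacency Lights Out game on a graph $G$: vertices labeled from $\mathbb{Z}_\ell$; toggling a vertex $v$ adds 1 (mod $\ell$) to the label of each vertex in the open neighborhood $N(v)$ (leaving $v$ unchanged); won when all labels are 0. $G$ is $A$-AW if this game is winnable from every initial labeling. For $U\subseteq V(G)$ and $r\in\mathbb{Z}_\ell$, $T_U^{A(G)}(r)\subseteq \mathbb{Z}_\ell$ is the set of $t$ such that the adjacency game on $G$ with initial labeling giving label $r$ to every vertex of $U$ and $0$ to all other vertices can be won with the vertices of $U$ collectively toggled $t$ times (mod $\ell$). -}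

module Defs where

open import Data.Nat using (ℕ; zero; suc; _+_; _<ᵇ_)
open import Data.Integer using (ℤ; +_; 0ℤ; _-_) renaming (_+_ to _+ℤ_)
open import Data.Integer.Divisibility using (_∣_)
open import Data.Bool using (Bool; true; false; if_then_else_; _∧_)
open import Data.Fin using (Fin; zero; suc; toℕ; splitAt; _≟_)
open import Data.Sum using (_⊎_; inj₁; inj₂)
open import Data.Product using (Σ; ∃; _×_; _,_)
open import Data.List using (List; []; _∷_; _++_; [_]; length)
open import Data.List.Relation.Unary.Linked using (Linked)
open import Data.List.Relation.Unary.AllPairs using (AllPairs)
open import Data.Nat using (_≤_)
open import Relation.Nullary using (¬_; yes; no)
open import Relation.Nullary.Decidable using (⌊_⌋)
open import Relation.Binary.PropositionalEquality using (_≡_; _≢_; refl; sym)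
open import Function.Bundles using (_⇔_)

record Graph (n : ℕ) : Set where
  field
    adj    : Fin n → Fin n → Bool
    adj-sym    : ∀ u v → adj u v ≡ adj v u
    adj-irrefl : ∀ v → adj v v ≡ false
open Graph public

sumℤ : (n : ℕ) → (Fin n → ℤ) → ℤ
sumℤ zero    f = 0ℤ
sumℤ (suc n) f = f zero +ℤ sumℤ n (λ i → f (suc i))

sumℕ : (n : ℕ) → (Fin n → ℕ) → ℕ
sumℕ zero    f = 0
sumℕ (suc n) f = f zero + sumℕ n (λ i → f (suc i))

size : ∀ {n} → Graph n → ℕ
size {n} G = sumℕ n (λ i → sumℕ n (λ j →
  if adj G i j ∧ (toℕ i <ᵇ toℕ j) then 1 else 0))

order : ∀ {n} → Graph n → ℕ
order {n} _ = n

-- The pendant graph H ⊙ K₁ on Fin (k + k):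
-- inj₁ v  (first k vertices) = vertex v of H,
-- inj₂ v  (last k vertices)  = the new pendant vertex attached to v.

private
  eqb : ∀ {k} → Fin k → Fin k → Bool
  eqb u v = ⌊ u ≟ v ⌋

  eqb-sym : ∀ {k} (u v : Fin k) → eqb u v ≡ eqb v u
  eqb-sym u v with u ≟ v | v ≟ u
  ... | yes _ | yes _ = refl
  ... | no  _ | no  _ = refl
  ... | yes refl | no ¬p = Data.Empty.⊥-elim (¬p refl)
    where import Data.Empty
  ... | no ¬p | yes refl = Data.Empty.⊥-elim (¬p refl)
    where import Data.Empty

  adj⊎ : ∀ {k} → Graph k → Fin k ⊎ Fin k → Fin k ⊎ Fin k → Bool
  adj⊎ H (inj₁ u) (inj₁ v) = adj H u v
  adj⊎ H (inj₁ u) (inj₂ v) = eqb u v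
  adj⊎ H (inj₂ u) (inj₁ v) = eqb u v
  adj⊎ H (inj₂ u) (inj₂ v) = false

  adj⊎-sym : ∀ {k} (H : Graph k) x y → adj⊎ H x y ≡ adj⊎ H y x
  adj⊎-sym H (inj₁ u) (inj₁ v) = adj-sym H u v
  adj⊎-sym H (inj₁ u) (inj₂ v) = eqb-sym u v
  adj⊎-sym H (inj₂ u) (inj₁ v) = eqb-sym u v
  adj⊎-sym H (inj₂ u) (inj₂ v) = refl

  adj⊎-irrefl : ∀ {k} (H : Graph k) x → adj⊎ H x x ≡ false
  adj⊎-irrefl H (inj₁ u) = adj-irrefl H u
  adj⊎-irrefl H (inj₂ u) = refl

_⊙K₁ : ∀ {k} → Graph k → Graph (k + k)
_⊙K₁ {k} H = record
  { adj        = λ x y → adj⊎ H (splitAt k x) (splitAt k y)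
  ; adj-sym    = λ x y → adj⊎-sym H (splitAt k x) (splitAt k y)
  ; adj-irrefl = λ x → adj⊎-irrefl H (splitAt k x)
  }

data Reachable {n} (G : Graph n) : Fin n → Fin n → Set where
  here : ∀ {v} → Reachable G v v
  step : ∀ {u v w} → adj G u v ≡ true → Reachable G v w → Reachable G u w

HasComponents : ∀ {n} → Graph n → ℕ → Set
HasComponents {n} G c =
  Σ (Fin n → Fin c) λ comp →
    (∀ i → ∃ λ v → comp v ≡ i) ×
    (∀ u v → (comp u ≡ comp v) ⇔ Reachable G u v)

HasCycle : ∀ {n} → Graph n → Set
HasCycle {n} G =
  Σ (Fin n) λ v → Σ (List (Fin n)) λ vs →
    (2 ≤ length vs) ×
    AllPairs _≢_ (v ∷ vs) ×
    Linked (λ a b → adj G a b ≡ true) (v ∷ vs ++ [ v ])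

Forest : ∀ {n} → Graph n → Set
Forest G = ¬ HasCycle G

-- Adjacency Lights Out over ℤ_ℓ.  Elements of ℤ_ℓ are represented by
-- integers, compared up to congruence mod ℓ.

_≡_[mod_] : ℤ → ℤ → ℕ → Set
a ≡ b [mod ℓ ] = (+ ℓ) ∣ (a - b)

Labeling : ℕ → Set
Labeling n = Fin n → ℤ

-- t v = number of times vertex v is toggled.  Toggling u adds 1 to every
-- vertex of N(u) (not to u itself).
finalLabel : ∀ {n} → Graph n → Labeling n → (Fin n → ℤ) → Fin n → ℤ
finalLabel {n} G L t v = L v +ℤ sumℤ n (λ u → if adj G u v then t u else 0ℤ)

WinsWith : ∀ {n} → Graph n → ℕ → Labeling n → (Fin n → ℤ) → Set
WinsWith G ℓ L t = ∀ v → finalLabel G L t v ≡ 0ℤ [mod ℓ ]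

Winnable : ∀ {n} → Graph n → ℕ → Labeling n → Set
Winnable {n} G ℓ L = ∃ λ (t : Fin n → ℤ) → WinsWith G ℓ L t

A-AW : ∀ {n} → Graph n → ℕ → Set
A-AW {n} G ℓ = ∀ (L : Labeling n) → Winnable G ℓ L

indicator : ∀ {n} → (Fin n → Bool) → ℤ → Labeling n
indicator U r v = if U v then r else 0ℤ

InT : ∀ {n} → Graph n → ℕ → (Fin n → Bool) → ℤ → ℤ → Set
InT {n} G ℓ U r x =
  ∃ λ (t : Fin n → ℤ) →
    WinsWith G ℓ (indicator U r) t ×
    (sumℤ n (λ u → if U u then t u else 0ℤ) ≡ x [mod ℓ ])

allV : ∀ {n} → Fin n → Bool
allV _ = true

-- In H ⊙ K₁ the leaf attached to i is adjacent to i alone, so a winning toggle vector is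
-- forced: the label of leaf i fixes the toggles at i, and then the label of i fixes the
-- toggles at leaf i. Hence every labelling is winnable, the solution is unique modulo ℓ,
-- and T(1) consists of its total number of toggles, which the handshake lemma turns into
-- 2(m − n). For (3), a forest with c components has n − c edges: after choosing a root in
-- each component, every edge joins a vertex to its parent on a shortest path to the root,
-- for otherwise the two root paths and the edge would close a cycle.
module Submission where

open import Defs
open import Data.Nat using (ℕ; _≤_)
open import Data.Integer using (ℤ; +_; -_; _-_; _*_)
open import Data.Product using (_×_)
open import Function.Bundles using (_⇔_)

import Data.Integer.Properties as ℤ
import Data.Nat.Properties as ℕ
open import Algebra.Properties.CommutativeSemigroup ℕ.+-commutativeSemigroup
  using () renaming (interchange to +-interchange)
open import Algebra.Properties.CommutativeSemigroup ℤ.+-commutativeSemigroup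
  using () renaming (interchange to +ℤ-interchange)
open import Data.Bool using (Bool; true; false; if_then_else_; _∧_; not)
open import Data.Bool.Properties using (∧-comm) renaming (_≟_ to _≟ᵇ_)
open import Data.Empty using (⊥-elim)
open import Data.Fin using (Fin; zero; suc; toℕ; _↑ˡ_; _↑ʳ_; splitAt)
open import Data.Fin.Properties
  using (_≟_; toℕ-injective; splitAt-↑ˡ; splitAt-↑ʳ; join-splitAt; any?)
open import Data.Integer using (0ℤ) renaming (_+_ to _+ℤ_)
open import Data.Integer.Divisibility.Signed
  using (_∣_; divides; ∣ᵤ⇒∣; ∣⇒∣ᵤ; ∣m∣n⇒∣m+n; ∣m⇒∣-m; ∣m∣n⇒∣m-n; ∣m+n∣m⇒∣n)
open import Data.Integer.Tactic.RingSolver using (solve-∀)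
open import Data.List using (List; []; _∷_; _++_; [_]; length)
open import Data.List.Relation.Unary.All using ([])
open import Data.List.Relation.Unary.All.Properties using (¬Any⇒All¬)
open import Data.List.Relation.Unary.AllPairs using (AllPairs; []; _∷_)
open import Data.List.Relation.Unary.Any using (here; there)
open import Data.List.Relation.Unary.Linked using (Linked; []; [-]; _∷_)
open import Data.Nat using (zero; suc; _+_; _<_; _<ᵇ_; z≤n; s≤s; ⌊_/2⌋)
open import Data.Nat.Induction using (<-wellFounded)
open import Data.Product using (Σ; ∃; _,_; proj₁; proj₂)
open import Data.Sum using (_⊎_; inj₁; inj₂; [_,_]′)
open import Function using (_∘_; _on_; flip)
open import Function.Bundles using (mk⇔; Equivalence)
open import Induction.WellFounded using (Acc; acc)
open import Relation.Binary.Construct.Closure.ReflexiveTransitive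
  using (Star; ε; _◅_; _◅◅_; reverse)
open import Relation.Binary.Construct.On using () renaming (wellFounded to on-wellFounded)
open import Relation.Binary.PropositionalEquality hiding ([_])
open import Relation.Nullary using (¬_; Dec; yes; no)
open import Relation.Nullary.Decidable
  using (⌊_⌋; does; ⌊⌋-map′; dec-true; dec-false; _×-dec_; _⊎-dec_; ¬?)

𝟙 : Bool → ℕ
𝟙 b = if b then 1 else 0

sumℕ-cong : ∀ n {f g : Fin n → ℕ} → (∀ i → f i ≡ g i) → sumℕ n f ≡ sumℕ n g
sumℕ-cong zero    f≗g = refl
sumℕ-cong (suc n) f≗g = cong₂ _+_ (f≗g zero) (sumℕ-cong n (f≗g ∘ suc))

sumℕ-zero : ∀ n → sumℕ n (λ _ → 0) ≡ 0
sumℕ-zero zero    = refl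
sumℕ-zero (suc n) = sumℕ-zero n

sumℕ-one : ∀ n → sumℕ n (λ _ → 1) ≡ n
sumℕ-one zero    = refl
sumℕ-one (suc n) = cong suc (sumℕ-one n)

sumℕ-+ : ∀ n (f g : Fin n → ℕ) → sumℕ n (λ i → f i + g i) ≡ sumℕ n f + sumℕ n g
sumℕ-+ zero    f g = refl
sumℕ-+ (suc n) f g = trans (cong (_+_ (f zero + g zero)) (sumℕ-+ n (f ∘ suc) (g ∘ suc)))
                           (+-interchange (f zero) (g zero) _ _)

sumℕ-swap : ∀ m n (f : Fin m → Fin n → ℕ) →
  sumℕ m (λ i → sumℕ n (f i)) ≡ sumℕ n (λ j → sumℕ m (λ i → f i j))
sumℕ-swap zero    n f = sym (sumℕ-zero n)
sumℕ-swap (suc m) n f = trans (cong (_+_ (sumℕ n (f zero))) (sumℕ-swap m n (f ∘ suc)))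
                              (sym (sumℕ-+ n (f zero) _))

sumℕ-select : ∀ n (a : Fin n) (p : Fin n → Bool) →
  sumℕ n (λ j → 𝟙 (does (j ≟ a) ∧ p j)) ≡ 𝟙 (p a)
sumℕ-select (suc n) zero    p = trans (cong (_+_ (𝟙 (p zero))) (sumℕ-zero n)) (ℕ.+-identityʳ _)
sumℕ-select (suc n) (suc a) p = sumℕ-select n a (p ∘ suc)

∣0ℤ : ∀ {m} → m ∣ 0ℤ
∣0ℤ = divides 0ℤ refl

sumℤ-cong : ∀ n {f g : Fin n → ℤ} → (∀ i → f i ≡ g i) → sumℤ n f ≡ sumℤ n g
sumℤ-cong zero    f≗g = refl
sumℤ-cong (suc n) f≗g = cong₂ _+ℤ_ (f≗g zero) (sumℤ-cong n (f≗g ∘ suc))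

sumℤ-zero : ∀ n → sumℤ n (λ _ → 0ℤ) ≡ 0ℤ
sumℤ-zero zero    = refl
sumℤ-zero (suc n) = trans (ℤ.+-identityˡ _) (sumℤ-zero n)

sumℤ-const : ∀ n a → sumℤ n (λ _ → a) ≡ + n * a
sumℤ-const zero    a = sym (ℤ.*-zeroˡ a)
sumℤ-const (suc n) a = begin
  a +ℤ sumℤ n (λ _ → a)  ≡⟨ cong₂ _+ℤ_ (sym (ℤ.*-identityˡ a)) (sumℤ-const n a) ⟩
  + 1 * a +ℤ + n * a     ≡⟨ ℤ.*-distribʳ-+ a (+ 1) (+ n) ⟨
  + suc n * a            ∎
  where open ≡-Reasoning

sumℤ-+ : ∀ n (f g : Fin n → ℤ) → sumℤ n (λ i → f i +ℤ g i) ≡ sumℤ n f +ℤ sumℤ n g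
sumℤ-+ zero    f g = refl
sumℤ-+ (suc n) f g = trans (cong ((f zero +ℤ g zero) +ℤ_) (sumℤ-+ n (f ∘ suc) (g ∘ suc)))
                           (+ℤ-interchange (f zero) (g zero) _ _)

sumℤ-neg : ∀ n (f : Fin n → ℤ) → sumℤ n (λ i → - f i) ≡ - sumℤ n f
sumℤ-neg zero    f = refl
sumℤ-neg (suc n) f = trans (cong (- f zero +ℤ_) (sumℤ-neg n (f ∘ suc)))
                           (sym (ℤ.neg-distrib-+ (f zero) _))

sumℤ-sub : ∀ n (f g : Fin n → ℤ) → sumℤ n (λ i → f i - g i) ≡ sumℤ n f - sumℤ n g
sumℤ-sub n f g = trans (sumℤ-+ n f (-_ ∘ g)) (cong (sumℤ n f +ℤ_) (sumℤ-neg n g))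

sumℤ-pos : ∀ n (f : Fin n → ℕ) → sumℤ n (+_ ∘ f) ≡ + sumℕ n f
sumℤ-pos zero    f = refl
sumℤ-pos (suc n) f = cong (+ f zero +ℤ_) (sumℤ-pos n (f ∘ suc))

sumℤ-++ : ∀ m n (f : Fin (m + n) → ℤ) →
  sumℤ (m + n) f ≡ sumℤ m (λ i → f (i ↑ˡ n)) +ℤ sumℤ n (λ j → f (m ↑ʳ j))
sumℤ-++ zero    n f = sym (ℤ.+-identityˡ _)
sumℤ-++ (suc m) n f = trans (cong (f zero +ℤ_) (sumℤ-++ m n (f ∘ suc)))
                            (sym (ℤ.+-assoc (f zero) _ _))

sumℤ-select : ∀ n (a : Fin n) (f : Fin n → ℤ) →
  sumℤ n (λ j → if ⌊ j ≟ a ⌋ then f j else 0ℤ) ≡ f a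
sumℤ-select (suc n) zero    f = trans (cong (f zero +ℤ_) (sumℤ-zero n)) (ℤ.+-identityʳ _)
sumℤ-select (suc n) (suc a) f = begin
  0ℤ +ℤ sumℤ n (λ j → if ⌊ suc j ≟ suc a ⌋ then f (suc j) else 0ℤ)
    ≡⟨ ℤ.+-identityˡ _ ⟩
  sumℤ n (λ j → if ⌊ suc j ≟ suc a ⌋ then f (suc j) else 0ℤ)
    ≡⟨ sumℤ-cong n (λ j → cong (if_then f (suc j) else 0ℤ) (⌊⌋-map′ _ _ (j ≟ a))) ⟩
  sumℤ n (λ j → if ⌊ j ≟ a ⌋ then f (suc j) else 0ℤ)
    ≡⟨ sumℤ-select n a (f ∘ suc) ⟩
  f (suc a) ∎
  where open ≡-Reasoning

sumℤ-∣ : ∀ {m} n {f : Fin n → ℤ} → (∀ i → m ∣ f i) → m ∣ sumℤ n f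
sumℤ-∣ zero    m∣f = ∣0ℤ
sumℤ-∣ (suc n) m∣f = ∣m∣n⇒∣m+n (m∣f zero) (sumℤ-∣ n (m∣f ∘ suc))

double-injective : ∀ {a b} → a + a ≡ b + b → a ≡ b
double-injective {a} {b} a+a≡b+b =
  trans (ℕ.n≡⌊n+n/2⌋ a) (trans (cong ⌊_/2⌋ a+a≡b+b) (sym (ℕ.n≡⌊n+n/2⌋ b)))

𝟙-<ᵇ-trichotomy : ∀ {m n} → m ≢ n → 𝟙 (m <ᵇ n) + 𝟙 (n <ᵇ m) ≡ 1
𝟙-<ᵇ-trichotomy {zero}  {zero}  m≢n = ⊥-elim (m≢n refl)
𝟙-<ᵇ-trichotomy {zero}  {suc n} _   = refl
𝟙-<ᵇ-trichotomy {suc m} {zero}  _   = refl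
𝟙-<ᵇ-trichotomy {suc m} {suc n} m≢n = 𝟙-<ᵇ-trichotomy (m≢n ∘ cong suc)

module _ {n} (G : Graph n) where

  𝟙-adj-oriented : ∀ u v →
    𝟙 (adj G u v) ≡ 𝟙 (adj G u v ∧ (toℕ u <ᵇ toℕ v)) + 𝟙 (adj G v u ∧ (toℕ v <ᵇ toℕ u))
  𝟙-adj-oriented u v rewrite adj-sym G v u with adj G u v in uv
  ... | false = refl
  ... | true  = sym (𝟙-<ᵇ-trichotomy (λ u≡v → loop (toℕ-injective u≡v)))
    where
    loop : u ≢ v
    loop refl with () ← trans (sym uv) (adj-irrefl G u)

  handshake : sumℕ n (λ v → sumℕ n (λ u → 𝟙 (adj G u v))) ≡ size G + size G
  handshake = begin
    sumℕ n (λ v → sumℕ n (λ u → 𝟙 (adj G u v)))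
      ≡⟨ sumℕ-cong n (λ v → sumℕ-cong n (λ u → 𝟙-adj-oriented u v)) ⟩
    sumℕ n (λ v → sumℕ n (λ u → forward u v + forward v u))
      ≡⟨ sumℕ-cong n (λ v → sumℕ-+ n _ _) ⟩
    sumℕ n (λ v → sumℕ n (λ u → forward u v) + sumℕ n (forward v))
      ≡⟨ sumℕ-+ n _ _ ⟩
    sumℕ n (λ v → sumℕ n (λ u → forward u v)) + size G
      ≡⟨ cong₂ _+_ (sumℕ-swap n n (λ v u → forward u v)) refl ⟩
    size G + size G ∎
    where
    open ≡-Reasoning
    forward : Fin n → Fin n → ℕ
    forward u v = 𝟙 (adj G u v ∧ (toℕ u <ᵇ toℕ v))

sumOver : ∀ {n} → (Fin n → Bool) → (Fin n → ℤ) → ℤ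
sumOver {n} U t = sumℤ n (λ u → if U u then t u else 0ℤ)

-- finalLabel G L t v is definitionally L v +ℤ neighbourSum G t v.
neighbourSum : ∀ {n} → Graph n → (Fin n → ℤ) → Fin n → ℤ
neighbourSum G t v = sumOver (λ u → adj G u v) t

degree : ∀ {n} → Graph n → Fin n → ℤ
degree G = neighbourSum G (λ _ → + 1)

sumOver-cong : ∀ {n} {U V : Fin n → Bool} {t s : Fin n → ℤ} →
  (∀ u → U u ≡ V u) → (∀ u → t u ≡ s u) → sumOver U t ≡ sumOver V s
sumOver-cong {n} U≗V t≗s = sumℤ-cong n (λ u → cong₂ (if_then_else 0ℤ) (U≗V u) (t≗s u))

module _ {n} (U : Fin n → Bool) where

  sumOver-sub : ∀ (t s : Fin n → ℤ) → sumOver U (λ u → t u - s u) ≡ sumOver U t - sumOver U s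
  sumOver-sub t s = trans (sumℤ-cong n (λ u → if-sub (U u))) (sumℤ-sub n _ _)
    where
    if-sub : ∀ b {x y} → (if b then x - y else 0ℤ) ≡ (if b then x else 0ℤ) - (if b then y else 0ℤ)
    if-sub true  = refl
    if-sub false = refl

  sumOver-neg : ∀ (t : Fin n → ℤ) → sumOver U (-_ ∘ t) ≡ - sumOver U t
  sumOver-neg t = trans (sumℤ-cong n (λ u → if-neg (U u))) (sumℤ-neg n _)
    where
    if-neg : ∀ b {x} → (if b then - x else 0ℤ) ≡ - (if b then x else 0ℤ)
    if-neg true  = refl
    if-neg false = refl

  sumOver-∣ : ∀ {m} {t : Fin n → ℤ} → (∀ u → m ∣ t u) → m ∣ sumOver U t
  sumOver-∣ m∣t = sumℤ-∣ n (λ u → if-∣ (U u) (m∣t u))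
    where
    if-∣ : ∀ {m x} b → m ∣ x → m ∣ (if b then x else 0ℤ)
    if-∣ true  m∣x = m∣x
    if-∣ false _   = ∣0ℤ

degree-sum : ∀ {n} (G : Graph n) → sumℤ n (degree G) ≡ + (size G + size G)
degree-sum {n} G = begin
  sumℤ n (degree G)
    ≡⟨ sumℤ-cong n (λ v → trans (sumℤ-cong n (λ u → if-one (adj G u v))) (sumℤ-pos n _)) ⟩
  sumℤ n (λ v → + sumℕ n (λ u → 𝟙 (adj G u v)))
    ≡⟨ sumℤ-pos n _ ⟩
  + sumℕ n (λ v → sumℕ n (λ u → 𝟙 (adj G u v)))
    ≡⟨ cong +_ (handshake G) ⟩
  + (size G + size G) ∎
  where
  open ≡-Reasoning
  if-one : ∀ b → (if b then + 1 else 0ℤ) ≡ + 𝟙 b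
  if-one true  = refl
  if-one false = refl

mod⇒∣ : ∀ {a b ℓ} → a ≡ b [mod ℓ ] → + ℓ ∣ a - b
mod⇒∣ = ∣ᵤ⇒∣

∣⇒mod : ∀ {a b ℓ} → + ℓ ∣ a - b → a ≡ b [mod ℓ ]
∣⇒mod = ∣⇒∣ᵤ

AdjacencyInjective : ∀ {n} → Graph n → ℕ → Set
AdjacencyInjective {n} G ℓ =
  ∀ (d : Fin n → ℤ) → (∀ v → + ℓ ∣ neighbourSum G d v) → ∀ v → + ℓ ∣ d v

module _ {n} (G : Graph n) (ℓ : ℕ) where

  winsWith-exact : ∀ L t → (∀ v → finalLabel G L t v ≡ 0ℤ) → WinsWith G ℓ L t
  winsWith-exact L t wins v rewrite wins v = ∣⇒mod {0ℤ} {0ℤ} ∣0ℤ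

  wins⇒∣ : ∀ L t → WinsWith G ℓ L t → ∀ v → + ℓ ∣ finalLabel G L t v
  wins⇒∣ L t wins v =
    subst (+ ℓ ∣_) (ℤ.+-identityʳ _) (mod⇒∣ {finalLabel G L t v} {0ℤ} (wins v))

  module _ (injective : AdjacencyInjective G ℓ) where

    winners-agree : ∀ L {t s} → WinsWith G ℓ L t → WinsWith G ℓ L s → ∀ v → + ℓ ∣ t v - s v
    winners-agree L {t} {s} t-wins s-wins = injective (λ u → t u - s u) λ v →
      subst (+ ℓ ∣_) (difference v) (∣m∣n⇒∣m-n (wins⇒∣ L t t-wins v) (wins⇒∣ L s s-wins v))
      where
      cancel : ∀ a x y → (a +ℤ x) - (a +ℤ y) ≡ x - y
      cancel = solve-∀
      difference : ∀ v → finalLabel G L t v - finalLabel G L s v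
                       ≡ neighbourSum G (λ u → t u - s u) v
      difference v = trans (cancel (L v) _ _) (sym (sumOver-sub (λ u → adj G u v) t s))

    InT-characterisation : ∀ U r {s} → WinsWith G ℓ (indicator U r) s → ∀ x →
      InT G ℓ U r x ⇔ (x ≡ sumOver U s [mod ℓ ])
    InT-characterisation U r {s} s-wins x = mk⇔ to from
      where
      sub-sub : ∀ a b c → (a - b) - (a - c) ≡ c - b
      sub-sub = solve-∀
      neg-sub : ∀ a b → - (a - b) ≡ b - a
      neg-sub = solve-∀
      to : InT G ℓ U r x → x ≡ sumOver U s [mod ℓ ]
      to (t , t-wins , Σt≡x) = ∣⇒mod {x} (subst (+ ℓ ∣_) rearrange
        (∣m∣n⇒∣m-n (sumOver-∣ U (winners-agree (indicator U r) t-wins s-wins))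
                   (mod⇒∣ {sumOver U t} Σt≡x)))
        where
        rearrange : sumOver U (λ u → t u - s u) - (sumOver U t - x) ≡ x - sumOver U s
        rearrange = trans (cong (_- (sumOver U t - x)) (sumOver-sub U t s))
                          (sub-sub (sumOver U t) (sumOver U s) x)
      from : x ≡ sumOver U s [mod ℓ ] → InT G ℓ U r x
      from x≡Σs = s , s-wins ,
        ∣⇒mod {sumOver U s} (subst (+ ℓ ∣_) (neg-sub x _) (∣m⇒∣-m (mod⇒∣ {x} x≡Σs)))

least : {P : ℕ → Set} → (∀ d → Dec (P d)) → ∀ {m} → P m →
  Σ ℕ λ d → P d × (∀ {j} → P j → d ≤ j)
least {P} P? {zero} p0 = 0 , p0 , λ _ → z≤n
least {P} P? {suc m} pm with P? 0
... | yes p0 = 0 , p0 , λ _ → z≤n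
... | no ¬p0 with least (P? ∘ suc) pm
...   | d , pd , minimal = suc d , pd , above
  where
  above : ∀ {j} → P j → suc d ≤ j
  above {zero}  p0 = ⊥-elim (¬p0 p0)
  above {suc j} pj = s≤s (minimal pj)

module _ {n} {R : Fin n → Fin n → Set} where

  vertices : ∀ {u w} → Star R u w → List (Fin n)
  vertices ε                  = []
  vertices (_◅_ {j = v} _ q) = v ∷ vertices q

  open import Data.List.Membership.DecPropositional (_≟_ {n}) using (_∈_; _∈?_)

  private
    dropUntil : ∀ {u v w} (q : Star R v w) → AllPairs _≢_ (v ∷ vertices q) → u ∈ v ∷ vertices q →
                Σ (Star R u w) λ q′ → AllPairs _≢_ (u ∷ vertices q′)
    dropUntil q       simple       (here refl) = q , simple
    dropUntil (_ ◅ q) (_ ∷ simple) (there u∈q) = dropUntil q simple u∈q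

  loopErase : ∀ {u w} → Star R u w → Σ (Star R u w) λ q → AllPairs _≢_ (u ∷ vertices q)
  loopErase ε = ε , ([] ∷ [])
  loopErase (_◅_ {i = u} {j = v} r q) with loopErase q
  ... | q′ , simple with u ∈? v ∷ vertices q′
  ...   | yes u∈q′ = dropUntil q′ simple u∈q′
  ...   | no  u∉q′ = r ◅ q′ , (¬Any⇒All¬ _ u∉q′ ∷ simple)

  linked-closing : ∀ {S : Fin n → Fin n → Set} → (∀ {x y} → R x y → S x y) →
    ∀ {u w x} (q : Star R u w) → S w x → Linked S (u ∷ vertices q ++ [ x ])
  linked-closing R⊆S ε       wx = wx ∷ [-]
  linked-closing R⊆S (r ◅ q) wx = R⊆S r ∷ linked-closing R⊆S q wx

  vertices-length : ∀ {u w} → u ≢ w → ¬ R u w → (q : Star R u w) → 2 ≤ length (vertices q)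
  vertices-length u≢u _   ε               = ⊥-elim (u≢u refl)
  vertices-length _   ¬uw (uw ◅ ε)        = ⊥-elim (¬uw uw)
  vertices-length _   _   (_ ◅ _ ◅ _)     = s≤s (s≤s z≤n)

AdjExcept : ∀ {n} → Graph n → Fin n → Fin n → Fin n → Fin n → Set
AdjExcept G a b x y = adj G x y ≡ true × ¬ (x ≡ a × y ≡ b) × ¬ (x ≡ b × y ≡ a)

AdjExcept-sym : ∀ {n} {G : Graph n} {a b x y} → AdjExcept G a b x y → AdjExcept G a b y x
AdjExcept-sym {G = G} {x = x} {y} (xy , ¬ab , ¬ba) =
  trans (adj-sym G y x) xy , (λ (ya , xb) → ¬ba (xb , ya)) , (λ (yb , xa) → ¬ab (xa , yb))

detour⇒cycle : ∀ {n} (G : Graph n) {a b} →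
  adj G a b ≡ true → Star (AdjExcept G a b) a b → HasCycle G
detour⇒cycle G {a} {b} ab detour =
  a , vertices path , vertices-length a≢b (λ (_ , ¬ab , _) → ¬ab (refl , refl)) path ,
  simple , linked-closing proj₁ path (trans (adj-sym G b a) ab)
  where
  path = proj₁ (loopErase detour)
  simple = proj₂ (loopErase detour)
  a≢b : a ≢ b
  a≢b refl with () ← trans (sym ab) (adj-irrefl G a)

module _ {n} (G : Graph n) where

  WalkWithin : ℕ → Fin n → Fin n → Set
  WalkWithin zero    u v = u ≡ v
  WalkWithin (suc d) u v = u ≡ v ⊎ ∃ λ w → adj G u w ≡ true × WalkWithin d w v

  walkWithin? : ∀ d u v → Dec (WalkWithin d u v)
  walkWithin? zero    u v = u ≟ v
  walkWithin? (suc d) u v = u ≟ v ⊎-dec any? (λ w → (adj G u w ≟ᵇ true) ×-dec walkWithin? d w v)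

  reachable⇒walkWithin : ∀ {u v} → Reachable G u v → ∃ λ d → WalkWithin d u v
  reachable⇒walkWithin here = 0 , refl
  reachable⇒walkWithin (step {v = w} uw reach) =
    let d , walk = reachable⇒walkWithin reach in suc d , inj₂ (w , uw , walk)

module Rooted {n} (G : Graph n) (root : Fin n → Fin n)
  (root-adj : ∀ {u v} → adj G u v ≡ true → root u ≡ root v)
  (reach-root : ∀ v → Reachable G v (root v)) where

  private
    shortest : ∀ v → Σ ℕ λ d → WalkWithin G d v (root v) ×
                                (∀ {j} → WalkWithin G j v (root v) → d ≤ j)
    shortest v = least (λ d → walkWithin? G d v (root v))
                       (proj₂ (reachable⇒walkWithin G (reach-root v)))

  dist : Fin n → ℕ
  dist v = proj₁ (shortest v)

  private
    firstHop : ∀ {v} d → WalkWithin G d v (root v) →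
               Σ (Fin n) λ w → v ≢ root v → adj G v w ≡ true × dist w < d
    firstHop {v} zero    v≡r         = v , λ v≢r → ⊥-elim (v≢r v≡r)
    firstHop {v} (suc d) (inj₁ v≡r) = v , λ v≢r → ⊥-elim (v≢r v≡r)
    firstHop (suc d) (inj₂ (w , vw , walk)) =
      w , λ _ → vw , s≤s (proj₂ (proj₂ (shortest w)) (subst (WalkWithin G d w) (root-adj vw) walk))


    hop : ∀ v → Σ (Fin n) λ w → v ≢ root v → adj G v w ≡ true × dist w < dist v
    hop v = firstHop (dist v) (proj₁ (proj₂ (shortest v)))

  parent : Fin n → Fin n
  parent v = proj₁ (hop v)

  parent-adj : ∀ {v} → v ≢ root v → adj G v (parent v) ≡ true
  parent-adj {v} v≢r = proj₁ (proj₂ (hop v) v≢r)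

  parent-closer : ∀ {v} → v ≢ root v → dist (parent v) < dist v
  parent-closer {v} v≢r = proj₂ (proj₂ (hop v) v≢r)

  walkToRoot : ∀ {R : Fin n → Fin n → Set} → (∀ {v} → v ≢ root v → R v (parent v)) →
               ∀ v → Star R v (root v)
  walkToRoot {R} parent-step v = go v (on-wellFounded dist <-wellFounded v)
    where
    go : ∀ v → Acc (_<_ on dist) v → Star R v (root v)
    go v (acc rec) with v ≟ root v
    ... | yes v≡r = subst (Star R v) v≡r ε
    ... | no  v≢r = parent-step v≢r ◅ subst (Star R (parent v)) (sym (root-adj (parent-adj v≢r)))
                                     (go (parent v) (rec (parent-closer v≢r)))

  ParentEdge : Fin n → Fin n → Set
  ParentEdge u v = v ≡ parent u × u ≢ root u

  parentEdge? : ∀ u v → Dec (ParentEdge u v)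
  parentEdge? u v = (v ≟ parent u) ×-dec ¬? (u ≟ root u)

  parentEdge⇒adj : ∀ {u v} → ParentEdge u v → adj G u v ≡ true
  parentEdge⇒adj {u} (refl , u≢r) = parent-adj u≢r

  parentEdge-asym : ∀ {u v} → ParentEdge u v → ¬ ParentEdge v u
  parentEdge-asym {u} {v} (v≡pu , u≢r) (u≡pv , v≢r) =
    ℕ.<-asym (subst (λ w → dist w < dist u) (sym v≡pu) (parent-closer u≢r))
             (subst (λ w → dist w < dist v) (sym u≡pv) (parent-closer v≢r))

  module _ (acyclic : Forest G) where

    parentEdge-complete : ∀ {a b} → adj G a b ≡ true → ParentEdge a b ⊎ ParentEdge b a
    parentEdge-complete {a} {b} ab with parentEdge? a b | parentEdge? b a
    ... | yes a→b | _       = inj₁ a→b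
    ... | no _    | yes b→a = inj₂ b→a
    ... | no ¬a→b | no ¬b→a = ⊥-elim (acyclic (detour⇒cycle G ab detour))
      where
      not-parentEdge : ∀ {x y v} → ¬ ParentEdge x y → v ≢ root v → ¬ (v ≡ x × parent v ≡ y)
      not-parentEdge ¬x→y v≢r (refl , refl) = ¬x→y (refl , v≢r)
      avoids : ∀ {v} → v ≢ root v → AdjExcept G a b v (parent v)
      avoids v≢r = parent-adj v≢r , not-parentEdge ¬a→b v≢r , not-parentEdge ¬b→a v≢r
      detour : Star (AdjExcept G a b) a b
      detour = walkToRoot avoids a ◅◅
               subst (λ r → Star (AdjExcept G a b) r b) (sym (root-adj ab))
                     (reverse (AdjExcept-sym {G = G}) (walkToRoot avoids b))

    parentCount : Fin n → Fin n → ℕ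
    parentCount u v = 𝟙 (does (parentEdge? u v))

    𝟙-adj≡parentCounts : ∀ u v → 𝟙 (adj G u v) ≡ parentCount u v + parentCount v u
    𝟙-adj≡parentCounts u v with adj G u v in uv
    ... | false = sym (cong₂ _+_ (cong 𝟙 (dec-false (parentEdge? u v) u↛v))
                                 (cong 𝟙 (dec-false (parentEdge? v u) v↛u)))
      where
      u↛v : ¬ ParentEdge u v
      u↛v u→v with () ← trans (sym uv) (parentEdge⇒adj u→v)
      v↛u : ¬ ParentEdge v u
      v↛u v→u with () ← trans (sym uv) (trans (adj-sym G u v) (parentEdge⇒adj v→u))
    ... | true with parentEdge-complete uv
    ...   | inj₁ u→v = sym (cong₂ _+_ (cong 𝟙 (dec-true (parentEdge? u v) u→v))
                                      (cong 𝟙 (dec-false (parentEdge? v u) (parentEdge-asym u→v))))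
    ...   | inj₂ v→u = sym (cong₂ _+_ (cong 𝟙 (dec-false (parentEdge? u v)
                                                         (flip parentEdge-asym v→u)))
                                      (cong 𝟙 (dec-true (parentEdge? v u) v→u)))

    parentCount-row : ∀ u → sumℕ n (parentCount u) ≡ 𝟙 (not (does (u ≟ root u)))
    parentCount-row u = sumℕ-select n (parent u) (λ _ → not (does (u ≟ root u)))

    size≡nonRoots : size G ≡ sumℕ n (λ u → 𝟙 (not (does (u ≟ root u))))
    size≡nonRoots = double-injective (begin
      size G + size G
        ≡⟨ handshake G ⟨
      sumℕ n (λ v → sumℕ n (λ u → 𝟙 (adj G u v)))
        ≡⟨ sumℕ-cong n (λ v → sumℕ-cong n (λ u → 𝟙-adj≡parentCounts u v)) ⟩
      sumℕ n (λ v → sumℕ n (λ u → parentCount u v + parentCount v u))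
        ≡⟨ sumℕ-cong n (λ v → sumℕ-+ n _ _) ⟩
      sumℕ n (λ v → sumℕ n (λ u → parentCount u v) + sumℕ n (parentCount v))
        ≡⟨ sumℕ-+ n _ _ ⟩
      sumℕ n (λ v → sumℕ n (λ u → parentCount u v)) + sumℕ n (λ v → sumℕ n (parentCount v))
        ≡⟨ cong₂ _+_ (sumℕ-swap n n (λ v u → parentCount u v)) refl ⟩
      sumℕ n (λ u → sumℕ n (parentCount u)) + sumℕ n (λ v → sumℕ n (parentCount v))
        ≡⟨ cong (λ x → x + x) (sumℕ-cong n parentCount-row) ⟩
      sumℕ n (λ u → 𝟙 (not (does (u ≟ root u)))) + sumℕ n (λ u → 𝟙 (not (does (u ≟ root u)))) ∎)
      where open ≡-Reasoning

fixedPoints-section∘retraction : ∀ {n c} (f : Fin n → Fin c) (g : Fin c → Fin n) →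
  (∀ x → f (g x) ≡ x) → sumℕ n (λ u → 𝟙 (does (u ≟ g (f u)))) ≡ c
fixedPoints-section∘retraction {n} {c} f g f∘g≗id = begin
  sumℕ n (λ u → 𝟙 (does (u ≟ g (f u))))
    ≡⟨ sumℕ-cong n (λ u → sumℕ-select c (f u) (λ x → does (u ≟ g x))) ⟨
  sumℕ n (λ u → sumℕ c (λ x → 𝟙 (does (x ≟ f u) ∧ does (u ≟ g x))))
    ≡⟨ sumℕ-swap n c _ ⟩
  sumℕ c (λ x → sumℕ n (λ u → 𝟙 (does (x ≟ f u) ∧ does (u ≟ g x))))
    ≡⟨ sumℕ-cong c (λ x → sumℕ-cong n (λ u → cong 𝟙 (∧-comm (does (x ≟ f u)) _))) ⟩
  sumℕ c (λ x → sumℕ n (λ u → 𝟙 (does (u ≟ g x) ∧ does (x ≟ f u))))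
    ≡⟨ sumℕ-cong c (λ x → sumℕ-select n (g x) (λ u → does (x ≟ f u))) ⟩
  sumℕ c (λ x → 𝟙 (does (x ≟ f (g x))))
    ≡⟨ sumℕ-cong c (λ x → cong 𝟙 (dec-true (x ≟ f (g x)) (sym (f∘g≗id x)))) ⟩
  sumℕ c (λ _ → 1)
    ≡⟨ sumℕ-one c ⟩
  c ∎
  where open ≡-Reasoning

forest-size+components : ∀ {n} (G : Graph n) {c} → Forest G → HasComponents G c → size G + c ≡ n
forest-size+components {n} G {c} acyclic (comp , comp-onto , same-comp⇔reachable) = begin
  size G + c
    ≡⟨ cong₂ _+_ (size≡nonRoots acyclic)
                 (sym (fixedPoints-section∘retraction comp rep rep-section)) ⟩
  sumℕ n (λ u → 𝟙 (not (does (u ≟ root u)))) + sumℕ n (λ u → 𝟙 (does (u ≟ root u)))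
    ≡⟨ sumℕ-+ n _ _ ⟨
  sumℕ n (λ u → 𝟙 (not (does (u ≟ root u))) + 𝟙 (does (u ≟ root u)))
    ≡⟨ sumℕ-cong n (λ u → 𝟙-not+𝟙 (does (u ≟ root u))) ⟩
  sumℕ n (λ _ → 1)
    ≡⟨ sumℕ-one n ⟩
  n ∎
  where
  open ≡-Reasoning
  rep : Fin c → Fin n
  rep x = proj₁ (comp-onto x)
  rep-section : ∀ x → comp (rep x) ≡ x
  rep-section x = proj₂ (comp-onto x)
  root : Fin n → Fin n
  root = rep ∘ comp
  root-adj : ∀ {u v} → adj G u v ≡ true → root u ≡ root v
  root-adj {u} {v} uv = cong rep (Equivalence.from (same-comp⇔reachable u v) (step uv here))
  reach-root : ∀ v → Reachable G v (root v)
  reach-root v = Equivalence.to (same-comp⇔reachable v (root v)) (sym (rep-section (comp v)))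
  open Rooted G root root-adj reach-root
  𝟙-not+𝟙 : ∀ b → 𝟙 (not b) + 𝟙 b ≡ 1
  𝟙-not+𝟙 true  = refl
  𝟙-not+𝟙 false = refl

module PendantGraph {k} (H : Graph k) where

  inner leaf : Fin k → Fin (k + k)
  inner i = i ↑ˡ k
  leaf  i = k ↑ʳ i

  inner-or-leaf : (P : Fin (k + k) → Set) → (∀ i → P (inner i)) → (∀ i → P (leaf i)) → ∀ v → P v
  inner-or-leaf P p q v with splitAt k v | join-splitAt k k v
  ... | inj₁ i | i≡v = subst P i≡v (p i)
  ... | inj₂ i | i≡v = subst P i≡v (q i)

  adj-inner-inner : ∀ i j → adj (H ⊙K₁) (inner i) (inner j) ≡ adj H i j
  adj-inner-inner i j rewrite splitAt-↑ˡ k i k | splitAt-↑ˡ k j k = refl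

  adj-inner-leaf : ∀ i j → adj (H ⊙K₁) (inner i) (leaf j) ≡ ⌊ i ≟ j ⌋
  adj-inner-leaf i j rewrite splitAt-↑ˡ k i k | splitAt-↑ʳ k k j = refl

  adj-leaf-inner : ∀ i j → adj (H ⊙K₁) (leaf i) (inner j) ≡ ⌊ i ≟ j ⌋
  adj-leaf-inner i j rewrite splitAt-↑ʳ k k i | splitAt-↑ˡ k j k = refl

  adj-leaf-leaf : ∀ i j → adj (H ⊙K₁) (leaf i) (leaf j) ≡ false
  adj-leaf-leaf i j rewrite splitAt-↑ʳ k k i | splitAt-↑ʳ k k j = refl

  neighbourSum-leaf : ∀ t i → neighbourSum (H ⊙K₁) t (leaf i) ≡ t (inner i)
  neighbourSum-leaf t i = begin
    neighbourSum (H ⊙K₁) t (leaf i)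
      ≡⟨ sumℤ-++ k k _ ⟩
    sumOver (λ j → adj (H ⊙K₁) (inner j) (leaf i)) (t ∘ inner)
      +ℤ sumOver (λ j → adj (H ⊙K₁) (leaf j) (leaf i)) (t ∘ leaf)
      ≡⟨ cong₂ _+ℤ_ (sumOver-cong (λ j → adj-inner-leaf j i) (λ _ → refl))
                    (sumOver-cong (λ j → adj-leaf-leaf j i) (λ _ → refl)) ⟩
    sumOver (λ j → ⌊ j ≟ i ⌋) (t ∘ inner) +ℤ sumOver (λ _ → false) (t ∘ leaf)
      ≡⟨ cong₂ _+ℤ_ (sumℤ-select k i _) (sumℤ-zero k) ⟩
    t (inner i) +ℤ 0ℤ
      ≡⟨ ℤ.+-identityʳ _ ⟩
    t (inner i) ∎
    where open ≡-Reasoning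

  neighbourSum-inner : ∀ t i →
    neighbourSum (H ⊙K₁) t (inner i) ≡ neighbourSum H (t ∘ inner) i +ℤ t (leaf i)
  neighbourSum-inner t i = begin
    neighbourSum (H ⊙K₁) t (inner i)
      ≡⟨ sumℤ-++ k k _ ⟩
    sumOver (λ j → adj (H ⊙K₁) (inner j) (inner i)) (t ∘ inner)
      +ℤ sumOver (λ j → adj (H ⊙K₁) (leaf j) (inner i)) (t ∘ leaf)
      ≡⟨ cong₂ _+ℤ_ (sumOver-cong (λ j → adj-inner-inner j i) (λ _ → refl))
                    (sumOver-cong (λ j → adj-leaf-inner j i) (λ _ → refl)) ⟩
    neighbourSum H (t ∘ inner) i +ℤ sumOver (λ j → ⌊ j ≟ i ⌋) (t ∘ leaf)
      ≡⟨ cong (neighbourSum H (t ∘ inner) i +ℤ_) (sumℤ-select k i _) ⟩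
    neighbourSum H (t ∘ inner) i +ℤ t (leaf i) ∎
    where open ≡-Reasoning

  allOnes : Labeling (k + k)
  allOnes _ = + 1

  strategy : Labeling (k + k) → Fin (k + k) → ℤ
  strategy L v =
    [ (λ i → - L (leaf i)) , (λ i → - L (inner i) - neighbourSum H (λ j → - L (leaf j)) i) ]′
      (splitAt k v)

  strategy-inner : ∀ L i → strategy L (inner i) ≡ - L (leaf i)
  strategy-inner L i rewrite splitAt-↑ˡ k i k = refl

  strategy-leaf : ∀ L i →
    strategy L (leaf i) ≡ - L (inner i) - neighbourSum H (λ j → - L (leaf j)) i
  strategy-leaf L i rewrite splitAt-↑ʳ k k i = refl

  strategy-wins : ∀ L v → finalLabel (H ⊙K₁) L (strategy L) v ≡ 0ℤ
  strategy-wins L = inner-or-leaf _ at-inner at-leaf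
    where
    open ≡-Reasoning
    s = strategy L
    cancel : ∀ a b → a +ℤ (b +ℤ (- a - b)) ≡ 0ℤ
    cancel = solve-∀
    at-leaf : ∀ i → L (leaf i) +ℤ neighbourSum (H ⊙K₁) s (leaf i) ≡ 0ℤ
    at-leaf i = begin
      L (leaf i) +ℤ neighbourSum (H ⊙K₁) s (leaf i)
        ≡⟨ cong (L (leaf i) +ℤ_) (trans (neighbourSum-leaf s i) (strategy-inner L i)) ⟩
      L (leaf i) +ℤ - L (leaf i)
        ≡⟨ ℤ.+-inverseʳ (L (leaf i)) ⟩
      0ℤ ∎
    at-inner : ∀ i → L (inner i) +ℤ neighbourSum (H ⊙K₁) s (inner i) ≡ 0ℤ
    at-inner i = begin
      L (inner i) +ℤ neighbourSum (H ⊙K₁) s (inner i)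
        ≡⟨ cong (L (inner i) +ℤ_) (neighbourSum-inner s i) ⟩
      L (inner i) +ℤ (neighbourSum H (s ∘ inner) i +ℤ s (leaf i))
        ≡⟨ cong₂ (λ a b → L (inner i) +ℤ (a +ℤ b))
                 (sumOver-cong (λ _ → refl) (strategy-inner L)) (strategy-leaf L i) ⟩
      L (inner i) +ℤ (N +ℤ (- L (inner i) - N))
        ≡⟨ cancel (L (inner i)) N ⟩
      0ℤ ∎
      where
      N = neighbourSum H (λ j → - L (leaf j)) i

  adjacency-injective : ∀ ℓ → AdjacencyInjective (H ⊙K₁) ℓ
  adjacency-injective ℓ d ℓ∣Ad = inner-or-leaf _ at-inner at-leaf
    where
    at-inner : ∀ i → + ℓ ∣ d (inner i)
    at-inner i = subst (+ ℓ ∣_) (neighbourSum-leaf d i) (ℓ∣Ad (leaf i))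
    at-leaf : ∀ i → + ℓ ∣ d (leaf i)
    at-leaf i = ∣m+n∣m⇒∣n (subst (+ ℓ ∣_) (neighbourSum-inner d i) (ℓ∣Ad (inner i)))
                          (sumOver-∣ _ at-inner)

  strategy-allOnes-inner : ∀ i → strategy allOnes (inner i) ≡ degree (H ⊙K₁) (leaf i) - + 2
  strategy-allOnes-inner i = trans (strategy-inner allOnes i)
                                   (sym (cong (_- + 2) (neighbourSum-leaf (λ _ → + 1) i)))

  strategy-allOnes-leaf : ∀ i → strategy allOnes (leaf i) ≡ degree (H ⊙K₁) (inner i) - + 2
  strategy-allOnes-leaf i = begin
    strategy allOnes (leaf i)
      ≡⟨ strategy-leaf allOnes i ⟩
    - + 1 - neighbourSum H (λ _ → - + 1) i
      ≡⟨ cong (_-_ (- + 1)) (sumOver-neg (λ j → adj H j i) (λ _ → + 1)) ⟩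
    - + 1 - - degree H i
      ≡⟨ shift (degree H i) ⟩
    (degree H i +ℤ + 1) - + 2
      ≡⟨ cong (_- + 2) (neighbourSum-inner (λ _ → + 1) i) ⟨
    degree (H ⊙K₁) (inner i) - + 2 ∎
    where
    open ≡-Reasoning
    shift : ∀ d → - + 1 - - d ≡ (d +ℤ + 1) - + 2
    shift = solve-∀

  strategy-total : sumℤ (k + k) (strategy allOnes) ≡ + 2 * (+ size (H ⊙K₁) - + (k + k))
  strategy-total = begin
    sumℤ (k + k) (strategy allOnes)
      ≡⟨ sumℤ-++ k k _ ⟩
    sumℤ k (strategy allOnes ∘ inner) +ℤ sumℤ k (strategy allOnes ∘ leaf)
      ≡⟨ cong₂ _+ℤ_ (sumℤ-cong k strategy-allOnes-inner) (sumℤ-cong k strategy-allOnes-leaf) ⟩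
    sumℤ k (deg−2 ∘ leaf) +ℤ sumℤ k (deg−2 ∘ inner)
      ≡⟨ ℤ.+-comm (sumℤ k (deg−2 ∘ leaf)) _ ⟩
    sumℤ k (deg−2 ∘ inner) +ℤ sumℤ k (deg−2 ∘ leaf)
      ≡⟨ sumℤ-++ k k deg−2 ⟨
    sumℤ (k + k) deg−2
      ≡⟨ sumℤ-sub (k + k) (degree (H ⊙K₁)) (λ _ → + 2) ⟩
    sumℤ (k + k) (degree (H ⊙K₁)) - sumℤ (k + k) (λ _ → + 2)
      ≡⟨ cong₂ _-_ (trans (degree-sum (H ⊙K₁)) (ℤ.pos-+ m m)) (sumℤ-const (k + k) (+ 2)) ⟩
    (+ m +ℤ + m) - + (k + k) * + 2
      ≡⟨ double (+ m) (+ (k + k)) ⟩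
    + 2 * (+ m - + (k + k)) ∎
    where
    open ≡-Reasoning
    m = size (H ⊙K₁)
    deg−2 : Fin (k + k) → ℤ
    deg−2 v = degree (H ⊙K₁) v - + 2
    double : ∀ a b → (a +ℤ a) - b * + 2 ≡ + 2 * (a - b)
    double = solve-∀

  pendant-AW : ∀ ℓ → A-AW (H ⊙K₁) ℓ
  pendant-AW ℓ L = strategy L , winsWith-exact (H ⊙K₁) ℓ L (strategy L) (strategy-wins L)

  pendant-T : ∀ ℓ x → InT (H ⊙K₁) ℓ allV (+ 1) x
                        ⇔ (x ≡ + 2 * (+ size (H ⊙K₁) - + order (H ⊙K₁)) [mod ℓ ])
  pendant-T ℓ x = subst (λ y → InT (H ⊙K₁) ℓ allV (+ 1) x ⇔ (x ≡ y [mod ℓ ])) strategy-total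
    (InT-characterisation (H ⊙K₁) ℓ (adjacency-injective ℓ) allV (+ 1)
      (winsWith-exact (H ⊙K₁) ℓ allOnes (strategy allOnes) (strategy-wins allOnes)) x)

twice-size-minus-order : ∀ {m c n} → m + c ≡ n → + 2 * (+ m - + n) ≡ - (+ 2 * + c)
twice-size-minus-order {m} {c} refl =
  trans (cong (λ n → + 2 * (+ m - n)) (ℤ.pos-+ m c)) (cancel (+ m) (+ c))
  where
  cancel : ∀ a b → + 2 * (a - (a +ℤ b)) ≡ - (+ 2 * b)
  cancel = solve-∀

lemma3p9 : ∀ {k} (H : Graph k) →
    (∀ (ℓ : ℕ) → 1 ≤ ℓ → A-AW (H ⊙K₁) ℓ)
    × (∀ (ℓ : ℕ) → 1 ≤ ℓ → ∀ (x : ℤ) →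
         InT (H ⊙K₁) ℓ allV (+ 1) x
           ⇔ (x ≡ + 2 * (+ size (H ⊙K₁) - + order (H ⊙K₁)) [mod ℓ ]))
    × (∀ (c : ℕ) → Forest (H ⊙K₁) → HasComponents (H ⊙K₁) c →
         ∀ (ℓ : ℕ) → 1 ≤ ℓ → ∀ (x : ℤ) →
         InT (H ⊙K₁) ℓ allV (+ 1) x ⇔ (x ≡ - (+ 2 * + c) [mod ℓ ]))
lemma3p9 H =
  (λ ℓ _ → pendant-AW ℓ) ,
  (λ ℓ _ → pendant-T ℓ) ,
  (λ c acyclic components ℓ _ x →
    subst (λ y → InT (H ⊙K₁) ℓ allV (+ 1) x ⇔ (x ≡ y [mod ℓ ]))
          (twice-size-minus-order (forest-size+components (H ⊙K₁) acyclic components))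
          (pendant-T ℓ x))
  where open PendantGraph H
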